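{- Let $S$ be a 3-SAT instance and $G(S)$ the graph constructed from it as described in the context. Then for every variable $X_i$ of $S$, every connectivity basis of $G(S)$ contains at least one of the vertices $x_i^4$ and $x_i^5$.
   Context: All graphs are finite, simple and undirected. For distinct vertices $v,w$, $\kappa(v,w)$ is the maximum number of internally vertex-disjoint $v$–$w$ paths; $\kappa(v,v)=\infty$. A set $W=\{w_1,\ldots,w_k\}$ is resolving if the vectors $[\kappa(v,w_1),\ldots,\kappa(v,w_k)]$, $v\in V(G)$, are pairwise distinct; a connectivity basis is a resolving set of minimum size. Construction: $S$ is a 3-SAT instance with variables $X_1,\ldots,X_n$ and clauses $C_1,\ldots,C_m$ (each clause a disjunction of literals $X_i$ or $\overline{X}_i$); every variable occurs in some clause. For each variable $X_i$ take vertices $x_i^1,\ldots,x_i^5$ with edges $x_i^1x_i^2, x_i^1x_i^3, x_i^1x_i^4, x_i^1x_i^5, x_i^2x_i^3, x_i^2x_i^4, x_i^2x_i^5, x_i^3x_i^4, x_i^3x_i^5$. For each clause $C_j$ take vertices $c_j^1,\ldots,c_j^6$ with edges $c_j^ac_j^b$ for $a\in\{1,2\}$, $b\in\{3,4,5\}$, edges $c_j^3c_j^4, c_j^3c_j^5, c_j^4c_j^5$, and $c_j^6c_j^3, c_j^6c_j^4, c_j^6c_j^5$. If $X_i$ occurs as a positive literal in $C_j$, add edges $c_j^1x_i^1, c_j^2x_i^1, c_j^2x_i^2$; if $X_i$ occurs as a negative literal in $C_j$, add edges $c_j^1x_i^1, c_j^1x_i^2, c_j^2x_i^2$. For every pair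 of distinct clauses $C_j\neq C_k$ add edges $c_j^1c_k^1, c_j^1c_k^2, c_j^2c_k^1, c_j^2c_k^2$. No other edges. The resulting graph is $G(S)$; it is assumed to be connected. -}

module Defs where

open import Data.Nat using (ℕ; _≤_)
open import Data.Fin using (Fin; #_)
open import Data.Bool using (Bool; true; false)
open import Data.Product using (Σ; ∃; _×_; _,_; proj₁)
open import Data.Sum using (_⊎_)
open import Data.Empty using (⊥)
open import Data.List using (List; []; _∷_; _++_; length)
open import Data.List.Membership.Propositional using (_∈_)
open import Data.List.Relation.Unary.Unique.Propositional using (Unique)
open import Data.List.Relation.Unary.Linked using (Linked)
open import Relation.Binary.PropositionalEquality using (_≡_; _≢_)
open import Relation.Binary.Construct.Closure.ReflexiveTransitive using (Star)

-- connectivity values: finite numbers or ∞ (used for κ(v,v))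
data ℕ∞ : Set where
  fin : ℕ → ℕ∞
  ∞   : ℕ∞

module GraphNotions {V : Set} (Adj : V → V → Set) where

  -- a v–w path is given by its list of internal vertices; the full vertex
  -- sequence v ∷ inner ++ [w] must be without repetition and consecutive
  -- vertices must be adjacent.
  IsPath : V → V → List V → Set
  IsPath v w inner =
    Unique (v ∷ inner ++ w ∷ []) × Linked Adj (v ∷ inner ++ w ∷ [])

  DisjPaths : V → V → ℕ → Set
  DisjPaths v w k =
    Σ (Fin k → List V) λ P →
      (∀ i → IsPath v w (P i)) ×
      (∀ i j → i ≢ j → (P i ≢ P j) × (∀ z → z ∈ P i → z ∈ P j → ⊥))

  -- Kappa v w a  :  κ(v,w) = a
  data Kappa (v w : V) : ℕ∞ → Set where
    self  : v ≡ w → Kappa v w ∞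
    local : ∀ {k} → v ≢ w → DisjPaths v w k →
            (∀ k' → DisjPaths v w k' → k' ≤ k) → Kappa v w (fin k)

  SameKappa : V → V → V → Set
  SameKappa v v' w = ∀ a → (Kappa v w a → Kappa v' w a) × (Kappa v' w a → Kappa v w a)

  Resolving : List V → Set
  Resolving W = ∀ v v' → (∀ w → w ∈ W → SameKappa v v' w) → v ≡ v'

  ConnectivityBasis : List V → Set
  ConnectivityBasis W =
    Unique W × Resolving W ×
    (∀ W' → Unique W' → Resolving W' → length W ≤ length W')

  Connected : Set
  Connected = ∀ u v → Star Adj u v

-- 3-SAT instances: n variables, m clauses, each clause has 3 literals;
-- a literal is (i , true) for X_i and (i , false) for ¬X_i.

record SAT3 (n m : ℕ) : Set where
  field
    lit : Fin m → Fin 3 → Fin n × Bool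
open SAT3 public

-- vertices of G(S):  x i a = x_i^{a+1} (a : Fin 5),  c j a = c_j^{a+1} (a : Fin 6)
data Vtx (n m : ℕ) : Set where
  x : Fin n → Fin 5 → Vtx n m
  c : Fin m → Fin 6 → Vtx n m

-- (directed listing of the) edges of G(S)
data Edge {n m : ℕ} (S : SAT3 n m) : Vtx n m → Vtx n m → Set where
  x12 : ∀ i → Edge S (x i (# 0)) (x i (# 1))
  x13 : ∀ i → Edge S (x i (# 0)) (x i (# 2))
  x14 : ∀ i → Edge S (x i (# 0)) (x i (# 3))
  x15 : ∀ i → Edge S (x i (# 0)) (x i (# 4))
  x23 : ∀ i → Edge S (x i (# 1)) (x i (# 2))
  x24 : ∀ i → Edge S (x i (# 1)) (x i (# 3))
  x25 : ∀ i → Edge S (x i (# 1)) (x i (# 4))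
  x34 : ∀ i → Edge S (x i (# 2)) (x i (# 3))
  x35 : ∀ i → Edge S (x i (# 2)) (x i (# 4))
  c13 : ∀ j → Edge S (c j (# 0)) (c j (# 2))
  c14 : ∀ j → Edge S (c j (# 0)) (c j (# 3))
  c15 : ∀ j → Edge S (c j (# 0)) (c j (# 4))
  c23 : ∀ j → Edge S (c j (# 1)) (c j (# 2))
  c24 : ∀ j → Edge S (c j (# 1)) (c j (# 3))
  c25 : ∀ j → Edge S (c j (# 1)) (c j (# 4))
  c34 : ∀ j → Edge S (c j (# 2)) (c j (# 3))
  c35 : ∀ j → Edge S (c j (# 2)) (c j (# 4))
  c45 : ∀ j → Edge S (c j (# 3)) (c j (# 4))
  c63 : ∀ j → Edge S (c j (# 5)) (c j (# 2))
  c64 : ∀ j → Edge S (c j (# 5)) (c j (# 3))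
  c65 : ∀ j → Edge S (c j (# 5)) (c j (# 4))
  pos11 : ∀ {i j} k → lit S j k ≡ (i , true) → Edge S (c j (# 0)) (x i (# 0))
  pos21 : ∀ {i j} k → lit S j k ≡ (i , true) → Edge S (c j (# 1)) (x i (# 0))
  pos22 : ∀ {i j} k → lit S j k ≡ (i , true) → Edge S (c j (# 1)) (x i (# 1))
  neg11 : ∀ {i j} k → lit S j k ≡ (i , false) → Edge S (c j (# 0)) (x i (# 0))
  neg12 : ∀ {i j} k → lit S j k ≡ (i , false) → Edge S (c j (# 0)) (x i (# 1))
  neg22 : ∀ {i j} k → lit S j k ≡ (i , false) → Edge S (c j (# 1)) (x i (# 1))
  cc11 : ∀ {j k} → j ≢ k → Edge S (c j (# 0)) (c k (# 0))
  cc12 : ∀ {j k} → j ≢ k → Edge S (c j (# 0)) (c k (# 1))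
  cc21 : ∀ {j k} → j ≢ k → Edge S (c j (# 1)) (c k (# 0))
  cc22 : ∀ {j k} → j ≢ k → Edge S (c j (# 1)) (c k (# 1))

Adj : ∀ {n m} → SAT3 n m → Vtx n m → Vtx n m → Set
Adj S u v = Edge S u v ⊎ Edge S v u

EveryVarOccurs : ∀ {n m} → SAT3 n m → Set
EveryVarOccurs {n} {m} S = ∀ (i : Fin n) → ∃ λ (j : Fin m) → ∃ λ (k : Fin 3) → proj₁ (lit S j k) ≡ i

{-# OPTIONS --safe #-}
-- A resolving set separates every pair of vertices, but an automorphism that fixes the
-- set pointwise preserves every connectivity value towards it, so such an automorphism
-- must be the identity.  The vertices x_i^4 and x_i^5 are twins (both are adjacent to
-- exactly x_i^1, x_i^2, x_i^3), hence their transposition is an automorphism of G(S);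
-- it fixes every vertex other than these two, so a resolving set avoiding both is impossible.
module Submission where

open import Defs
open import Data.Nat using (ℕ)
open import Data.Fin using (Fin; #_)
import Data.Fin.Properties as Fin
open import Data.Sum using (_⊎_; inj₁; inj₂)
import Data.Sum as Sum
import Data.Sum.Properties as Sum
open import Data.Product using (_×_; _,_; proj₁; proj₂)
import Data.Product.Properties as Product
open import Data.List using (List; []; _∷_; _++_; map)
open import Data.List.Membership.Propositional using (_∈_)
open import Data.List.Membership.Propositional.Properties using (∈-map⁻)
open import Data.List.Properties using (map-++; map-injective)
open import Data.List.Relation.Unary.Linked using (Linked)
import Data.List.Relation.Unary.Linked as Linked
import Data.List.Relation.Unary.Linked.Properties as Linked
open import Data.List.Relation.Unary.Unique.Propositional using (Unique)
import Data.List.Relation.Unary.Unique.Propositional.Properties as Unique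
open import Function.Bundles using (_⇔_; mk⇔; Equivalence)
import Function.Properties.Equivalence as ⇔
open import Relation.Binary.Definitions using (DecidableEquality; Symmetric)
open import Relation.Nullary.Decidable using (yes; no; map′)
open import Relation.Nullary.Negation using (contradiction)
open import Relation.Binary.PropositionalEquality

module _ {V : Set} (Adj : V → V → Set) where
  open GraphNotions Adj

  record Automorphism : Set where
    field
      to         : V → V
      from       : V → V
      from∘to    : ∀ v → from (to v) ≡ v
      to∘from    : ∀ v → to (from v) ≡ v
      to-adj     : ∀ {u v} → Adj u v → Adj (to u) (to v)
      from-adj   : ∀ {u v} → Adj u v → Adj (from u) (from v)

    to-injective : ∀ {u v} → to u ≡ to v → u ≡ v
    to-injective {u} {v} eq = begin
      u             ≡⟨ sym (from∘to u) ⟩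
      from (to u)   ≡⟨ cong from eq ⟩
      from (to v)   ≡⟨ from∘to v ⟩
      v             ∎
      where open ≡-Reasoning

  inverse : Automorphism → Automorphism
  inverse f = record
    { to = from ; from = to ; from∘to = to∘from ; to∘from = from∘to
    ; to-adj = from-adj ; from-adj = to-adj }
    where open Automorphism f

  module _ (f : Automorphism) where
    open Automorphism f

    IsPath-map : ∀ {v w inner} → IsPath v w inner → IsPath (to v) (to w) (map to inner)
    IsPath-map {v} {w} {inner} (unique , linked) =
      subst Unique map-path (Unique.map⁺ to-injective unique) ,
      subst (Linked Adj) map-path (Linked.map⁺ (Linked.map to-adj linked))
      where
      map-path : map to (v ∷ inner ++ w ∷ []) ≡ to v ∷ map to inner ++ to w ∷ []
      map-path = cong (to v ∷_) (map-++ to inner (w ∷ []))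

    DisjPaths-map : ∀ {v w k} → DisjPaths v w k → DisjPaths (to v) (to w) k
    DisjPaths-map (P , paths , disjoint) =
      (λ p → map to (P p)) , (λ p → IsPath-map (paths p)) ,
      λ p q p≢q →
        (λ eq → proj₁ (disjoint p q p≢q) (map-injective to-injective eq)) ,
        λ z z∈p z∈q →
          let (y , y∈p , z≡y) = ∈-map⁻ to z∈p
              (y′ , y′∈q , z≡y′) = ∈-map⁻ to z∈q
              y≡y′ = to-injective (trans (sym z≡y) z≡y′)
          in proj₂ (disjoint p q p≢q) y y∈p (subst (_∈ P q) (sym y≡y′) y′∈q)

  -- Maximality of the transported path system is pulled back along the inverse.
  Kappa-map : (f : Automorphism) → ∀ {v w a} →
              Kappa v w a → Kappa (Automorphism.to f v) (Automorphism.to f w) a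
  Kappa-map f (self v≡w) = self (cong to v≡w)
    where open Automorphism f
  Kappa-map f {v} {w} (local v≢w paths maximal) =
    local (λ eq → v≢w (to-injective eq)) (DisjPaths-map f paths)
      λ k′ paths′ → maximal k′ (subst₂ (λ v′ w′ → DisjPaths v′ w′ k′)
                                       (from∘to v) (from∘to w)
                                       (DisjPaths-map (inverse f) paths′))
    where open Automorphism f

  resolving-rigid : ∀ {W} → Resolving W → (f : Automorphism) →
                    (∀ w → w ∈ W → Automorphism.to f w ≡ w) →
                    ∀ v → Automorphism.to f v ≡ v
  resolving-rigid {W} resolving f fixes v =
    sym (resolving v (to v) λ w w∈W a →
      subst (λ w′ → Kappa v w a → Kappa (to v) w′ a) (fixes w w∈W) (Kappa-map f) ,
      subst₂ (λ v′ w′ → Kappa (to v) w a → Kappa v′ w′ a)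
             (from∘to v) (from-fixes w∈W) (Kappa-map (inverse f)))
    where
    open Automorphism f
    from-fixes : ∀ {w} → w ∈ W → from w ≡ w
    from-fixes {w} w∈W = trans (cong from (sym (fixes w w∈W))) (from∘to w)

  Twins : V → V → Set
  Twins a b = ∀ u → Adj u a ⇔ Adj u b

  module Transposition (_≟_ : DecidableEquality V) (a b : V) where

    transpose : V → V
    transpose v with v ≟ a | v ≟ b
    ... | yes _ | _     = b
    ... | no _  | yes _ = a
    ... | no _  | no _  = v

    transpose-a : transpose a ≡ b
    transpose-a with a ≟ a
    ... | yes _  = refl
    ... | no a≢a = contradiction refl a≢a

    transpose-b : transpose b ≡ a
    transpose-b with b ≟ a | b ≟ b
    ... | yes b≡a | _       = b≡a
    ... | no _    | yes _   = refl
    ... | no _    | no b≢b  = contradiction refl b≢b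

    transpose-fixes : ∀ {v} → v ≢ a → v ≢ b → transpose v ≡ v
    transpose-fixes {v} v≢a v≢b with v ≟ a | v ≟ b
    ... | yes v≡a | _       = contradiction v≡a v≢a
    ... | no _    | yes v≡b = contradiction v≡b v≢b
    ... | no _    | no _    = refl

    transpose-involutive : ∀ v → transpose (transpose v) ≡ v
    transpose-involutive v with v ≟ a | v ≟ b
    ... | yes refl | _        = transpose-b
    ... | no _     | yes refl = transpose-a
    ... | no v≢a   | no v≢b   = transpose-fixes v≢a v≢b

    module _ (sym-adj : Symmetric Adj) (twins : Twins a b) where

      twins-transpose : ∀ v → Twins v (transpose v)
      twins-transpose v with v ≟ a | v ≟ b
      ... | yes refl | _        = twins
      ... | no _     | yes refl = λ u → ⇔.sym (twins u)
      ... | no _     | no _     = λ u → ⇔.refl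

      -- Every vertex is a twin of its image, so the endpoints of an edge can be moved one at a time.
      transpose-adj : ∀ {u v} → Adj u v → Adj (transpose u) (transpose v)
      transpose-adj {u} {v} u~v =
        Equivalence.to (twins-transpose v (transpose u))
          (sym-adj (Equivalence.to (twins-transpose u v) (sym-adj u~v)))

      transpose-automorphism : Automorphism
      transpose-automorphism = record
        { to = transpose ; from = transpose
        ; from∘to = transpose-involutive ; to∘from = transpose-involutive
        ; to-adj = transpose-adj ; from-adj = transpose-adj }

  twins-resolving : DecidableEquality V → Symmetric Adj →
                    ∀ {a b} → Twins a b → a ≢ b →
                    ∀ {W} → Resolving W → a ∈ W ⊎ b ∈ W
  twins-resolving _≟_ sym-adj {a} {b} twins a≢b {W} resolving
    with a ∈? W | b ∈? W
    where open import Data.List.Membership.DecPropositional _≟_ using (_∈?_)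
  ... | yes a∈W | _       = inj₁ a∈W
  ... | no _    | yes b∈W = inj₂ b∈W
  ... | no a∉W  | no b∉W  = contradiction (sym b≡a) a≢b
    where
    open Transposition _≟_ a b
    fixes-W : ∀ w → w ∈ W → transpose w ≡ w
    fixes-W w w∈W = transpose-fixes (λ { refl → a∉W w∈W }) (λ { refl → b∉W w∈W })
    b≡a : b ≡ a
    b≡a = trans (sym transpose-a)
            (resolving-rigid resolving (transpose-automorphism sym-adj twins) fixes-W a)

module _ {n m : ℕ} where

  _≟ⱽ_ : DecidableEquality (Vtx n m)
  u ≟ⱽ v = map′ encode-injective (cong encode)
                (Sum.≡-dec (Product.≡-dec Fin._≟_ Fin._≟_) (Product.≡-dec Fin._≟_ Fin._≟_)
                           (encode u) (encode v))
    where
    encode : Vtx n m → (Fin n × Fin 5) ⊎ (Fin m × Fin 6)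
    encode (x i a) = inj₁ (i , a)
    encode (c j a) = inj₂ (j , a)
    encode-injective : ∀ {u v} → encode u ≡ encode v → u ≡ v
    encode-injective {x _ _} {x _ _} refl = refl
    encode-injective {c _ _} {c _ _} refl = refl

  module _ (S : SAT3 n m) where

    Adj-sym : Symmetric (Adj S)
    Adj-sym = Sum.swap

    gadget-twins : ∀ i → Twins (Adj S) (x i (# 3)) (x i (# 4))
    gadget-twins i u = mk⇔ (Sum.map to4 λ ()) (Sum.map to3 λ ())
      where
      to4 : Edge S u (x i (# 3)) → Edge S u (x i (# 4))
      to4 (x14 i) = x15 i
      to4 (x24 i) = x25 i
      to4 (x34 i) = x35 i
      to3 : Edge S u (x i (# 4)) → Edge S u (x i (# 3))
      to3 (x15 i) = x14 i
      to3 (x25 i) = x24 i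
      to3 (x35 i) = x34 i

lemma4p2 : ∀ {n m : ℕ} (S : SAT3 n m) → EveryVarOccurs S →
    GraphNotions.Connected (Adj S) →
    (W : List (Vtx n m)) → GraphNotions.ConnectivityBasis (Adj S) W →
    (i : Fin n) → (x i (# 3) ∈ W) ⊎ (x i (# 4) ∈ W)
lemma4p2 S _ _ W (_ , resolving , _) i =
  twins-resolving (Adj S) _≟ⱽ_ (Adj-sym S) (gadget-twins S i) (λ ()) resolving
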